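{- Let $k,l,s$ be positive integers with $k\geq 4$ and $s\geq kl$, and let $c(k,s)>0$ be a constant such that every family $\mathcal{G}\subseteq\binom{[n]}{k}$ (for every $n$) contains a $(k,s)$-homogeneous subfamily $\mathcal{G}^*$ with $|\mathcal{G}^*|\geq c(k,s)|\mathcal{G}|$. Let $\mathcal{F}\subseteq\binom{[n]}{k}$ and suppose $\mathcal{F}$ contains no copy of $\mathbb{P}^{(k)}_l$. Then $\mathcal{F}$ can be partitioned into subfamilies $\mathcal{G}_1,\ldots,\mathcal{G}_m,\mathcal{F}_0$ (for some $m\ge 0$) such that for every $i\in[m]$, $\mathcal{G}_i$ is $(k,s)$-homogeneous with an intersection pattern $\mathcal{J}_i$ that has rank $k-1$ and is of type 1, and $|\mathcal{F}_0|\leq\frac{1}{c(k,s)}\binom{n}{k-2}$.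
   Context: A family $\mathcal{F}\subseteq\binom{[n]}{k}$ is $k$-partite with $k$-partition $(X_1,\ldots,X_k)$ if $X_1,\ldots,X_k$ partition $[n]$ and $|F\cap X_i|=1$ for all $F\in\mathcal{F}$, $i\in[k]$. For $S\subseteq[n]$ its pattern is $\Pi(S)=\{i: S\cap X_i\neq\emptyset\}$, and $\Pi(\mathcal{L})=\{\Pi(S):S\in\mathcal{L}\}$. For $F\in\mathcal{F}$, $\mathcal{I}(F,\mathcal{F})=\{F\cap F': F'\in\mathcal{F},F'\neq F\}$. An $s$-star with kernel $A$ is a family of sets $F_1,\ldots,F_s$ with $F_i\cap F_j=A$ for all $i<j$. A family $\mathcal{F}^*\subseteq\binom{[n]}{k}$ is $(k,s)$-homogeneous with intersection pattern $\mathcal{J}$ if: $\mathcal{F}^*$ is $k$-partite with a $k$-partition $(X_1,\ldots,X_k)$; $\mathcal{J}$ is a family of proper subsets of $[k]$ with $\Pi(\mathcal{I}(F,\mathcal{F}^*))=\mathcal{J}$ for all $F\in\mathcal{F}^*$; $\mathcal{J}$ is closed under intersection; and for every $F\in\mathcal{F}^*$ and every $A\in\mathcal{I}(F,\mathcal{F}^*)$ there is an $s$-star in $\mathcal{F}^*$ containing $F$ with kernel $A$. (By Füredi's intersection semilattice lemma, a constant $c(k,s)>0$ as in the claim exists.) The rank of a family $\mathcal{L}$ of subsets of $[k]$ is $r(\mathcal{L})=\min\{|D|: D\subseteq[k],\ \text{no } B\in\mathcal{L}\text{ satisfies } D\subseteq B\}$. A family $\mathcal{L}$ of rank $k-1$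 is of type 1 if there is $x\in[k]$ with $[k]\setminus\{x\}\notin\mathcal{L}$ but $[k]\setminus\{y\}\in\mathcal{L}$ for all $y\neq x$. A $k$-uniform linear path of length $l$, $\mathbb{P}^{(k)}_l$, is a family of $k$-sets $\{F_1,\ldots,F_l\}$ with $|F_i\cap F_{i+1}|=1$ for each $i$ and $F_i\cap F_j=\emptyset$ whenever $|i-j|>1$; a family contains a copy of it if some subfamily is isomorphic to it.
   Formalization: The constant $c(k,s)$ ranges over the positive rationals, both in the assumed homogeneous-subfamily property and in the bound on the size of the leftover family. -}

module Defs where

open import Level using (0ℓ)
open import Data.Nat using (ℕ; suc; _<_; _≤_; _∸_; _*_)
open import Data.Fin using (Fin; toℕ)
open import Data.Fin.Properties using (any?)
open import Data.Fin.Subset using (Subset; _∩_; ∣_∣; ⊥; ⊤; ∁; ⁅_⁆; _⊆_; Nonempty)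
open import Data.Fin.Subset.Properties using (_∈?_)
open import Data.Vec using (tabulate)
open import Data.List using (List; length; concat; _++_)
open import Data.List.Membership.Propositional using (_∈_)
open import Data.List.Relation.Unary.Unique.Propositional using (Unique)
open import Data.List.Relation.Binary.Subset.Propositional renaming (_⊆_ to _⊆ₗ_)
open import Data.List.Relation.Binary.Permutation.Propositional using (_↭_)
open import Data.Product using (Σ; ∃; ∃-syntax; _×_; _,_)
open import Relation.Nullary using (¬_; _×-dec_)
open import Relation.Nullary.Decidable using (⌊_⌋)
open import Relation.Binary.PropositionalEquality using (_≡_; _≢_)
open import Function.Bundles using (_⇔_)
open import Data.Fin using (_≟_)

-- A family of subsets of [n] = Fin n: a duplicate-free list of subsets.
Family : ℕ → Set
Family n = List (Subset n)

IsKFamily : (n k : ℕ) → Family n → Set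
IsKFamily n k 𝓕 = Unique 𝓕 × (∀ {F} → F ∈ 𝓕 → ∣ F ∣ ≡ k)

-- The part X_i of the k-partition given by the colouring χ : [n] → [k]
-- (X_i = χ⁻¹(i); the X_i partition [n]).
Part : {n k : ℕ} → (Fin n → Fin k) → Fin k → Subset n
Part χ i = tabulate (λ j → ⌊ χ j ≟ i ⌋)

IsKPartiteWith : {n k : ℕ} → (Fin n → Fin k) → Family n → Set
IsKPartiteWith {n} {k} χ 𝓕 = ∀ {F} → F ∈ 𝓕 → (i : Fin k) → ∣ F ∩ Part χ i ∣ ≡ 1

Π : {n k : ℕ} → (Fin n → Fin k) → Subset n → Subset k
Π χ S = tabulate (λ i → ⌊ any? (λ j → (j ∈? S) ×-dec (χ j ≟ i)) ⌋)

InI : {n : ℕ} → Subset n → Subset n → Family n → Set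
InI A F 𝓕 = ∃[ F' ] (F' ∈ 𝓕 × F' ≢ F × A ≡ F ∩ F')

-- Families of subsets of [k] (such as intersection patterns) as predicates.
SetFamily : ℕ → Set₁
SetFamily k = Subset k → Set

HasStar : {n : ℕ} → (s : ℕ) → Family n → Subset n → Subset n → Set
HasStar {n} s 𝓕 F A =
  Σ (Fin s → Subset n) λ f →
    (∀ i → f i ∈ 𝓕) × (∃[ i ] f i ≡ F) × (∀ i j → i ≢ j → f i ∩ f j ≡ A)

IsHomogeneousWith : (n k s : ℕ) → Family n → (Fin n → Fin k) → SetFamily k → Set
IsHomogeneousWith n k s 𝓕 χ 𝓙 =
  IsKFamily n k 𝓕 ×
  IsKPartiteWith χ 𝓕 ×
  (∀ B → 𝓙 B → B ≢ ⊤) ×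
  (∀ {F} → F ∈ 𝓕 → ∀ B → (𝓙 B ⇔ (∃[ A ] (InI A F 𝓕 × Π χ A ≡ B)))) ×
  (∀ B C → 𝓙 B → 𝓙 C → 𝓙 (B ∩ C)) ×
  (∀ {F} → F ∈ 𝓕 → ∀ A → InI A F 𝓕 → HasStar s 𝓕 F A)

IsHomogeneous : (n k s : ℕ) → Family n → Set₁
IsHomogeneous n k s 𝓕 = Σ (Fin n → Fin k) λ χ → Σ (SetFamily k) λ 𝓙 → IsHomogeneousWith n k s 𝓕 χ 𝓙

Uncovered : {k : ℕ} → SetFamily k → Subset k → Set
Uncovered 𝓛 D = ∀ B → 𝓛 B → ¬ (D ⊆ B)

HasRank : {k : ℕ} → SetFamily k → ℕ → Set
HasRank 𝓛 r = (∃[ D ] (Uncovered 𝓛 D × ∣ D ∣ ≡ r)) × (∀ D → Uncovered 𝓛 D → r ≤ ∣ D ∣)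

IsType1 : {k : ℕ} → SetFamily k → Set
IsType1 {k} 𝓛 = ∃[ x ] (¬ 𝓛 (∁ ⁅ x ⁆) × (∀ y → y ≢ x → 𝓛 (∁ ⁅ y ⁆)))

IsHomogeneousType1 : (n k s : ℕ) → Family n → Set₁
IsHomogeneousType1 n k s 𝓕 =
  Σ (Fin n → Fin k) λ χ → Σ (SetFamily k) λ 𝓙 →
    IsHomogeneousWith n k s 𝓕 χ 𝓙 × HasRank 𝓙 (k ∸ 1) × IsType1 𝓙

ContainsPath : {n : ℕ} → (l : ℕ) → Family n → Set
ContainsPath {n} l 𝓕 =
  Σ (Fin l → Subset n) λ g →
    (∀ i → g i ∈ 𝓕) ×
    (∀ i j → toℕ j ≡ suc (toℕ i) → ∣ g i ∩ g j ∣ ≡ 1) ×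
    (∀ i j → suc (toℕ i) < toℕ j → g i ∩ g j ≡ ⊥)

-- the constant c(k,s) = p / q has the homogeneous-subfamily property
HomogeneousConstant : (k s p q : ℕ) → Set₁
HomogeneousConstant k s p q =
  ∀ n (𝓖 : Family n) → IsKFamily n k 𝓖 →
    Σ (Family n) λ 𝓖* → Unique 𝓖* × 𝓖* ⊆ₗ 𝓖 × IsHomogeneous n k s 𝓖* × p * length 𝓖 ≤ q * length 𝓖*

module Submission where

-- Key fact: a (k,s)-homogeneous 𝓖 (partition χ, pattern 𝓙) with no linear path
-- of length l, s ≥ kl, k ≥ 4 and more than C(n,k-2) members has a rank-(k-1),
-- type-1 pattern.  Indeed (i) every D ⊆ [k] with |D| ≤ k-2 lies in a member of
-- 𝓙, since otherwise F ↦ F ∩ χ⁻¹(D) is injective on 𝓖 with |D|-element values;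
-- (ii) 𝓙 has no two distinct singletons, since their kernels let us grow a
-- linear path greedily inside stars of size s ≥ kl; and (iii) an
-- intersection-closed family of proper subsets with (i) and (ii) misses exactly
-- one co-singleton.  The theorem follows by repeatedly splitting off the
-- homogeneous subfamily of size ≥ (p/q)|𝓕| while p|𝓕| > q·C(n,k-2).

open import Defs
open import Data.Nat using (ℕ; zero; suc; _+_; _≤_; _<_; _*_; _∸_; z≤n; s≤s; s≤s⁻¹; _≤?_) renaming (_≟_ to _≟ℕ_)
open import Data.Nat.Properties
open import Data.Nat.Combinatorics using (_C_; nCk+nC[k+1]≡[n+1]C[k+1])
open import Data.Bool using (Bool; true; false; _∧_)
import Data.Bool as Bool
open import Data.Fin using (Fin; zero; suc; toℕ; punchIn) renaming (_≟_ to _≟ᶠ_)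
open import Data.Fin.Properties using (any?; punchInᵢ≢i; punchIn-injective; toℕ<n)
open import Data.Fin.Subset
open import Data.Fin.Subset.Properties
open import Data.Vec using ([]; _∷_; tabulate; lookup)
open import Data.Vec.Properties using (lookup∘tabulate; []=⇒lookup; lookup⇒[]=; ≡-dec)
open import Data.List using (List; []; _∷_; length; map; concat; _++_; filter; foldr; allFin)
import Data.List as List
open import Data.List.Properties using (length-map; length-tabulate; length-++; ++-assoc)
open import Data.List.Membership.Propositional using (find; lose) renaming (_∈_ to _∈ₗ_)
open import Data.List.Membership.Propositional.Properties
  using (∈-map⁻; ∈-allFin; ∈-filter⁻; ∈-filter⁺; ∈-++⁺ˡ; ∈-++⁺ʳ; ∈-++⁻)
open import Data.List.Membership.Propositional.Properties.WithK using (unique∧set⇒bag)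
open import Data.List.Relation.Binary.BagAndSetEquality using (∼bag⇒↭)
open import Data.List.Relation.Unary.Any as Any using (here; there)
open import Data.List.Relation.Unary.All as All using (All; []; _∷_)
open import Data.List.Relation.Unary.All.Properties using () renaming (tabulate⁺ to All-tabulate⁺)
open import Data.List.Relation.Unary.AllPairs using ([]; _∷_)
open import Data.List.Relation.Unary.Unique.Propositional using (Unique)
open import Data.List.Relation.Unary.Unique.Propositional.Properties
  using (filter⁺; ++⁺) renaming (tabulate⁺ to Unique-tabulate⁺)
open import Data.List.Relation.Binary.Permutation.Propositional using (_↭_; ↭-refl; ↭-reflexive; ↭-trans)
open import Data.List.Relation.Binary.Permutation.Propositional.Properties using (↭-length; ++⁺ˡ)
open import Data.Product using (Σ; ∃; ∃-syntax; _×_; _,_; proj₁; proj₂)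
open import Data.Sum using (inj₁; inj₂; [_,_]′)
open import Data.Empty using (⊥-elim)
open import Relation.Nullary using (¬_; Dec; yes; no; ¬?; _×-dec_)
open import Relation.Nullary.Decidable using (⌊_⌋; map′; decidable-stable; dec-true; isYes≗does)
open import Relation.Binary.PropositionalEquality
open import Function using (_∘_)
open import Function.Bundles using (_⇔_; mk⇔; Equivalence)
open Equivalence using (to; from)
open import Algebra.Properties.CommutativeMonoid.Sum +-0-commutativeMonoid
  using (sum; sum-cong-≗; ∑-distrib-+; sum-replicate-zero)

bit : Bool → ℕ
bit true = 1
bit false = 0

∣b∷p∣ : ∀ {n} b (p : Subset n) → ∣ b ∷ p ∣ ≡ bit b + ∣ p ∣
∣b∷p∣ true p = refl
∣b∷p∣ false p = refl

∈-tabulate⁻ : ∀ {n} {f : Fin n → Bool} {x} → x ∈ tabulate f → f x ≡ true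
∈-tabulate⁻ {f = f} {x} h = trans (sym (lookup∘tabulate f x)) ([]=⇒lookup h)

∈-tabulate⁺ : ∀ {n} {f : Fin n → Bool} {x} → f x ≡ true → x ∈ tabulate f
∈-tabulate⁺ {f = f} {x} h = lookup⇒[]= x (tabulate f) (trans (lookup∘tabulate f x) h)

∈-Part⁻ : ∀ {n k} {χ : Fin n → Fin k} {i j} → j ∈ Part χ i → χ j ≡ i
∈-Part⁻ {χ = χ} {i} {j} h with χ j ≟ᶠ i | ∈-tabulate⁻ {x = j} h
... | yes e | _ = e

∈-Part⁺ : ∀ {n k} {χ : Fin n → Fin k} {i j} → χ j ≡ i → j ∈ Part χ i
∈-Part⁺ {χ = χ} {i} {j} e = ∈-tabulate⁺ {f = λ j → ⌊ χ j ≟ᶠ i ⌋} (trans (isYes≗does (χ j ≟ᶠ i)) (dec-true (χ j ≟ᶠ i) e))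

∈-Π⁻ : ∀ {n k} {χ : Fin n → Fin k} {S i} → i ∈ Π χ S → ∃[ j ] (j ∈ S × χ j ≡ i)
∈-Π⁻ {χ = χ} {S} {i} h with any? (λ j → (j ∈? S) ×-dec (χ j ≟ᶠ i)) | ∈-tabulate⁻ {x = i} h
... | yes w | _ = w

∈-Π⁺ : ∀ {n k} {χ : Fin n → Fin k} {S j} → j ∈ S → χ j ∈ Π χ S
∈-Π⁺ {χ = χ} {S} {j} h =
  ∈-tabulate⁺ {f = λ i → ⌊ any? (λ j → (j ∈? S) ×-dec (χ j ≟ᶠ i)) ⌋}
    (trans (isYes≗does χS?) (dec-true χS? (j , h , refl)))
  where
  χS? : Dec (∃[ j' ] (j' ∈ S × χ j' ≡ χ j))
  χS? = any? (λ j' → (j' ∈? S) ×-dec (χ j' ≟ᶠ χ j))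

_≟ₛ_ : ∀ {n} (p q : Subset n) → Dec (p ≡ q)
_≟ₛ_ = ≡-dec Bool._≟_

∈⇒1≤∣p∣ : ∀ {n} {p : Subset n} {x} → x ∈ p → 1 ≤ ∣ p ∣
∈⇒1≤∣p∣ x∈p = ≤-<-trans z≤n (x∈p⇒∣p-x∣<∣p∣ x∈p)

∣p∣≡1⇒Nonempty : ∀ {n} {p : Subset n} → ∣ p ∣ ≡ 1 → Nonempty p
∣p∣≡1⇒Nonempty {n} {p} h with nonempty? p
... | yes ne = ne
... | no e = ⊥-elim (0≢1+n (trans (sym (∣⊥∣≡0 n)) (trans (cong ∣_∣ (sym (Empty-unique e))) h)))

∉-all⇒⊥ : ∀ {n} {p : Subset n} → (∀ {x} → x ∉ p) → p ≡ ⊥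
∉-all⇒⊥ h = Empty-unique (λ (x , x∈p) → h x∈p)

∣p∪q∣≤∣p∣+∣q∣ : ∀ {n} (p q : Subset n) → ∣ p ∪ q ∣ ≤ ∣ p ∣ + ∣ q ∣
∣p∪q∣≤∣p∣+∣q∣ [] [] = z≤n
∣p∪q∣≤∣p∣+∣q∣ (true ∷ p) (true ∷ q) = s≤s (≤-trans (∣p∪q∣≤∣p∣+∣q∣ p q) (+-monoʳ-≤ ∣ p ∣ (n≤1+n ∣ q ∣)))
∣p∪q∣≤∣p∣+∣q∣ (true ∷ p) (false ∷ q) = s≤s (∣p∪q∣≤∣p∣+∣q∣ p q)
∣p∪q∣≤∣p∣+∣q∣ (false ∷ p) (true ∷ q) = ≤-trans (s≤s (∣p∪q∣≤∣p∣+∣q∣ p q)) (≤-reflexive (sym (+-suc ∣ p ∣ ∣ q ∣)))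
∣p∪q∣≤∣p∣+∣q∣ (false ∷ p) (false ∷ q) = ∣p∪q∣≤∣p∣+∣q∣ p q

∃∉ : ∀ {k} (U : Subset k) → ∣ U ∣ < k → ∃[ w ] w ∉ U
∃∉ {k} U lt with any? (λ w → ¬? (w ∈? U))
... | yes w∉U = w∉U
... | no none = ⊥-elim (<⇒≱ lt (subst (_≤ ∣ U ∣) (∣⊤∣≡n k)
                  (p⊆q⇒∣p∣≤∣q∣ {p = ⊤} (λ {w} _ → decidable-stable (w ∈? U) (λ w∉U → none (w , w∉U))))))

enlarge : ∀ {k} (D : Subset k) r → ∣ D ∣ ≤ r → r ≤ k → ∃[ D' ] (D ⊆ D' × ∣ D' ∣ ≡ r)
enlarge [] zero _ _ = [] , (λ h → h) , refl
enlarge (true ∷ D) (suc r) (s≤s h1) (s≤s h2) with enlarge D r h1 h2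
... | D' , sub , e = true ∷ D' , in⊆in sub , cong suc e
enlarge {suc k} (false ∷ D) r h1 h2 with r ≤? k
... | no r≰k = ⊤ , ⊆⊤ , trans (∣⊤∣≡n (suc k)) (sym (≤-antisym h2 (≰⇒> r≰k)))
... | yes r≤k with enlarge D r h1 r≤k
...   | D' , sub , e = false ∷ D' , out⊆ sub , e

withHead : ∀ {n} → Bool → List (Subset (suc n)) → List (Subset n)
withHead b [] = []
withHead b ((c ∷ p) ∷ L) with b Bool.≟ c
... | yes _ = p ∷ withHead b L
... | no _ = withHead b L

length-withHead : ∀ {n} (L : List (Subset (suc n))) →
  length L ≡ length (withHead true L) + length (withHead false L)
length-withHead [] = refl
length-withHead ((true ∷ p) ∷ L) = cong suc (length-withHead L)
length-withHead ((false ∷ p) ∷ L) = trans (cong suc (length-withHead L)) (sym (+-suc _ _))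

∈-withHead : ∀ {n} b {p : Subset n} L → p ∈ₗ withHead b L → (b ∷ p) ∈ₗ L
∈-withHead b ((c ∷ q) ∷ L) h with b Bool.≟ c | h
... | yes refl | here refl = here refl
... | yes refl | there h' = there (∈-withHead b L h')
... | no _ | h' = there (∈-withHead b L h')

withHead-unique : ∀ {n} b (L : List (Subset (suc n))) → Unique L → Unique (withHead b L)
withHead-unique b [] _ = []
withHead-unique b ((c ∷ p) ∷ L) (p∉L ∷ u) with b Bool.≟ c
... | no _ = withHead-unique b L u
... | yes refl = All.tabulate (λ q∈ p≡q → All.lookup p∉L (∈-withHead b L q∈) (cong (b ∷_) p≡q))
                 ∷ withHead-unique b L u

withHead-size : ∀ {n} b r (L : List (Subset (suc n))) →
  All (λ S → ∣ S ∣ ≡ r) L → All (λ S → bit b + ∣ S ∣ ≡ r) (withHead b L)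
withHead-size b r [] _ = []
withHead-size b r ((c ∷ p) ∷ L) (e ∷ a) with b Bool.≟ c
... | yes refl = trans (sym (∣b∷p∣ b p)) e ∷ withHead-size b r L a
... | no _ = withHead-size b r L a

-- A duplicate-free list of r-subsets of [n] has at most C(n,r) members
-- (Pascal's rule, splitting on the first coordinate).
count-subsets : ∀ n r (L : List (Subset n)) → Unique L → All (λ S → ∣ S ∣ ≡ r) L → length L ≤ n C r
count-subsets zero r [] _ _ = z≤n
count-subsets zero zero ([] ∷ []) _ _ = ≤-refl
count-subsets zero (suc r) ([] ∷ []) _ (() ∷ _)
count-subsets zero r ([] ∷ [] ∷ L) ((distinct ∷ _) ∷ _) _ = ⊥-elim (distinct refl)
count-subsets (suc n) zero L u a = begin
    length L                                           ≡⟨ length-withHead L ⟩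
    length (withHead true L) + length (withHead false L)
      ≡⟨ cong (_+ length (withHead false L)) (none (withHead true L) (withHead-size true 0 L a)) ⟩
    length (withHead false L)
      ≤⟨ count-subsets n zero _ (withHead-unique false L u) (withHead-size false 0 L a) ⟩
    1 ∎
  where
  open ≤-Reasoning
  none : ∀ (M : List (Subset n)) → All (λ S → suc ∣ S ∣ ≡ 0) M → length M ≡ 0
  none [] _ = refl
  none (_ ∷ _) (() ∷ _)
count-subsets (suc n) (suc r) L u a = begin
    length L                                           ≡⟨ length-withHead L ⟩
    length (withHead true L) + length (withHead false L)
      ≤⟨ +-mono-≤ (count-subsets n r _ (withHead-unique true L u) (All.map suc-injective (withHead-size true (suc r) L a)))
                  (count-subsets n (suc r) _ (withHead-unique false L u) (withHead-size false (suc r) L a)) ⟩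
    n C r + n C suc r                                  ≡⟨ nCk+nC[k+1]≡[n+1]C[k+1] n r ⟩
    suc n C suc r ∎
  where open ≤-Reasoning

count-elements : ∀ {n} (U : Subset n) (L : List (Fin n)) → Unique L → All (_∈ U) L → length L ≤ ∣ U ∣
count-elements U [] _ _ = z≤n
count-elements U (x ∷ L) (x∉L ∷ u) (x∈U ∷ a) =
  ≤-<-trans (count-elements (U - x) L u (All.zipWith in-U-x (x∉L , a))) (x∈p⇒∣p-x∣<∣p∣ x∈U)
  where
  in-U-x : ∀ {y} → x ≢ y × y ∈ U → y ∈ U - x
  in-U-x (x≢y , y∈U) = x∈p∧x≢y⇒x∈p-y y∈U (x≢y ∘ sym)

map-unique : ∀ {A B : Set} (f : A → B) (xs : List A) → Unique xs →
  (∀ {x y} → x ∈ₗ xs → y ∈ₗ xs → f x ≡ f y → x ≡ y) → Unique (map f xs)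
map-unique f [] _ _ = []
map-unique f (x ∷ xs) (x∉xs ∷ u) inj =
  All.tabulate (λ fy∈ fx≡ → new (∈-map⁻ f fy∈) fx≡) ∷ map-unique f xs u (λ hx hy → inj (there hx) (there hy))
  where
  new : ∀ {z} → ∃[ y ] (y ∈ₗ xs × z ≡ f y) → ¬ (f x ≡ z)
  new (y , y∈xs , refl) fx≡fy = All.lookup x∉xs y∈xs (inj (here refl) (there y∈xs) fx≡fy)

preimage : ∀ {n k} → (Fin n → Fin k) → Subset k → Subset n
preimage χ D = tabulate (λ j → lookup D (χ j))

sum-zero : ∀ {k} (f : Fin k → ℕ) → (∀ i → f i ≡ 0) → sum f ≡ 0
sum-zero {k} f f≡0 = trans (sum-cong-≗ f≡0) (sum-replicate-zero k)

sum-indicator : ∀ {k} (c : Fin k) → sum (λ i → bit ⌊ c ≟ᶠ i ⌋) ≡ 1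
sum-indicator {suc k} zero = cong suc (sum-zero _ off)
  where
  off : ∀ (i : Fin k) → bit ⌊ zero ≟ᶠ suc i ⌋ ≡ 0
  off i with zero ≟ᶠ suc i
  ... | no _ = refl
sum-indicator {suc k} (suc c) = cong₂ _+_ off (trans (sum-cong-≗ shift) (sum-indicator c))
  where
  off : bit ⌊ suc c ≟ᶠ zero ⌋ ≡ 0
  off with suc c ≟ᶠ zero
  ... | no _ = refl
  shift : ∀ (i : Fin k) → bit ⌊ suc c ≟ᶠ suc i ⌋ ≡ bit ⌊ c ≟ᶠ i ⌋
  shift i with c ≟ᶠ i
  ... | yes refl = refl
  ... | no _ = refl

∣S∣≡∑∣S∩Part∣ : ∀ {n k} (χ : Fin n → Fin k) (S : Subset n) → ∣ S ∣ ≡ sum (λ i → ∣ S ∩ Part χ i ∣)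
∣S∣≡∑∣S∩Part∣ {zero} {k} χ [] = sym (sum-zero {k} _ (λ _ → refl))
∣S∣≡∑∣S∩Part∣ {suc n} {k} χ (b ∷ S) = begin
    ∣ b ∷ S ∣                                            ≡⟨ ∣b∷p∣ b S ⟩
    bit b + ∣ S ∣                                        ≡⟨ cong₂ _+_ (sym (first b)) (∣S∣≡∑∣S∩Part∣ (χ ∘ suc) S) ⟩
    sum (λ i → bit (b ∧ ⌊ χ zero ≟ᶠ i ⌋)) + sum (λ i → ∣ S ∩ Part (χ ∘ suc) i ∣)
                                                         ≡⟨ sym (∑-distrib-+ {k} _ _) ⟩
    sum (λ i → bit (b ∧ ⌊ χ zero ≟ᶠ i ⌋) + ∣ S ∩ Part (χ ∘ suc) i ∣)
                                                         ≡⟨ sum-cong-≗ (λ i → sym (∣b∷p∣ _ (S ∩ Part (χ ∘ suc) i))) ⟩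
    sum (λ i → ∣ (b ∷ S) ∩ Part χ i ∣) ∎
  where
  open ≡-Reasoning
  first : ∀ b → sum (λ i → bit (b ∧ ⌊ χ zero ≟ᶠ i ⌋)) ≡ bit b
  first true = sum-indicator (χ zero)
  first false = sum-zero {k} _ (λ _ → refl)

∑bit≡∣D∣ : ∀ {k} (D : Subset k) → sum (λ i → bit (lookup D i)) ≡ ∣ D ∣
∑bit≡∣D∣ [] = refl
∑bit≡∣D∣ (b ∷ D) = trans (cong (bit b +_) (∑bit≡∣D∣ D)) (sym (∣b∷p∣ b D))

transversal-count : ∀ {n k} (χ : Fin n → Fin k) (F : Subset n) (D : Subset k) →
  (∀ i → ∣ F ∩ Part χ i ∣ ≡ 1) → ∣ F ∩ preimage χ D ∣ ≡ ∣ D ∣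
transversal-count {n} χ F D transversal =
  trans (∣S∣≡∑∣S∩Part∣ χ (F ∩ preimage χ D)) (trans (sum-cong-≗ per-part) (∑bit≡∣D∣ D))
  where
  in-preimage : ∀ {i j} → j ∈ Part χ i → lookup D i ≡ lookup D (χ j)
  in-preimage j∈Xi = cong (lookup D) (sym (∈-Part⁻ j∈Xi))
  per-part : ∀ i → ∣ (F ∩ preimage χ D) ∩ Part χ i ∣ ≡ bit (lookup D i)
  per-part i with lookup D i in i∈?D
  ... | true = trans (cong ∣_∣ (⊆-antisym drop keep)) (transversal i)
    where
    drop : (F ∩ preimage χ D) ∩ Part χ i ⊆ F ∩ Part χ i
    drop h with x∈p∩q⁻ _ _ h
    ... | h₁ , h₂ = x∈p∩q⁺ (proj₁ (x∈p∩q⁻ _ _ h₁) , h₂)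
    keep : F ∩ Part χ i ⊆ (F ∩ preimage χ D) ∩ Part χ i
    keep h with x∈p∩q⁻ _ _ h
    ... | j∈F , j∈Xi = x∈p∩q⁺ (x∈p∩q⁺ (j∈F , ∈-tabulate⁺ (trans (sym (in-preimage j∈Xi)) i∈?D)) , j∈Xi)
  ... | false = trans (cong ∣_∣ (∉-all⇒⊥ none)) (∣⊥∣≡0 n)
    where
    none : ∀ {j} → j ∉ (F ∩ preimage χ D) ∩ Part χ i
    none h with x∈p∩q⁻ _ _ h
    ... | h₁ , j∈Xi with trans (sym (∈-tabulate⁻ (proj₂ (x∈p∩q⁻ _ _ h₁)))) (trans (sym (in-preimage j∈Xi)) i∈?D)
    ... | ()

module Homogeneous {n k s : ℕ} (𝓖 : Family n) (χ : Fin n → Fin k) (𝓙 : SetFamily k)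
  (H : IsHomogeneousWith n k s 𝓖 χ 𝓙) where

  unique : Unique 𝓖
  unique = proj₁ (proj₁ H)

  uniform : ∀ {F} → F ∈ₗ 𝓖 → ∣ F ∣ ≡ k
  uniform = proj₂ (proj₁ H)

  partite : IsKPartiteWith χ 𝓖
  partite = proj₁ (proj₂ H)

  proper : ∀ B → 𝓙 B → B ≢ ⊤
  proper = proj₁ (proj₂ (proj₂ H))

  realises : ∀ {F} → F ∈ₗ 𝓖 → ∀ B → (𝓙 B ⇔ (∃[ A ] (InI A F 𝓖 × Π χ A ≡ B)))
  realises = proj₁ (proj₂ (proj₂ (proj₂ H)))

  ∩-closed : ∀ B C → 𝓙 B → 𝓙 C → 𝓙 (B ∩ C)
  ∩-closed = proj₁ (proj₂ (proj₂ (proj₂ (proj₂ H))))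

  stars : ∀ {F} → F ∈ₗ 𝓖 → ∀ A → InI A F 𝓖 → HasStar s 𝓖 F A
  stars = proj₂ (proj₂ (proj₂ (proj₂ (proj₂ H))))

  -- 𝓙 is decidable: it is the set of patterns of intersections with a fixed member.
  𝓙? : ∀ {F₀} → F₀ ∈ₗ 𝓖 → ∀ B → Dec (𝓙 B)
  𝓙? {F₀} F₀∈𝓖 B =
    map′ (λ w → from (realises F₀∈𝓖 B) (witness (find w))) (λ j → search (to (realises F₀∈𝓖 B) j))
      (Any.any? (λ F' → ¬? (F' ≟ₛ F₀) ×-dec (Π χ (F₀ ∩ F') ≟ₛ B)) 𝓖)
    where
    witness : ∃[ F' ] (F' ∈ₗ 𝓖 × (F' ≢ F₀ × Π χ (F₀ ∩ F') ≡ B)) → ∃[ A ] (InI A F₀ 𝓖 × Π χ A ≡ B)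
    witness (F' , F'∈𝓖 , F'≢F₀ , e) = F₀ ∩ F' , (F' , F'∈𝓖 , F'≢F₀ , refl) , e
    search : ∃[ A ] (InI A F₀ 𝓖 × Π χ A ≡ B) → Any.Any (λ F' → F' ≢ F₀ × Π χ (F₀ ∩ F') ≡ B) 𝓖
    search (A , (F' , F'∈𝓖 , F'≢F₀ , refl) , e) = lose F'∈𝓖 (F'≢F₀ , e)

  vertex-of-colour : ∀ {F} → F ∈ₗ 𝓖 → ∀ i → ∃[ j ] (j ∈ F × χ j ≡ i)
  vertex-of-colour F∈𝓖 i with ∣p∣≡1⇒Nonempty (partite F∈𝓖 i)
  ... | j , j∈ = j , proj₁ (x∈p∩q⁻ _ _ j∈) , ∈-Part⁻ (proj₂ (x∈p∩q⁻ _ _ j∈))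

  -- If D is covered by no member of 𝓙 then F ↦ F ∩ χ⁻¹(D) is injective on 𝓖:
  -- two members agreeing there would meet in every colour of D.  Hence
  -- |𝓖| ≤ C(n,|D|).
  uncovered-bound : ∀ D → Uncovered 𝓙 D → length 𝓖 ≤ n C ∣ D ∣
  uncovered-bound D uncovered =
    subst (_≤ n C ∣ D ∣) (length-map trace 𝓖)
      (count-subsets n ∣ D ∣ (map trace 𝓖) (map-unique trace 𝓖 unique injective) (All.tabulate size))
    where
    trace : Subset n → Subset n
    trace F = F ∩ preimage χ D
    size : ∀ {S} → S ∈ₗ map trace 𝓖 → ∣ S ∣ ≡ ∣ D ∣
    size S∈ with ∈-map⁻ trace S∈
    ... | F , F∈𝓖 , refl = transversal-count χ F D (partite F∈𝓖)
    injective : ∀ {F F'} → F ∈ₗ 𝓖 → F' ∈ₗ 𝓖 → trace F ≡ trace F' → F ≡ F'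
    injective {F} {F'} F∈𝓖 F'∈𝓖 same with F' ≟ₛ F
    ... | yes F'≡F = sym F'≡F
    ... | no F'≢F = ⊥-elim (uncovered (Π χ (F ∩ F')) in𝓙 D⊆)
      where
      in𝓙 : 𝓙 (Π χ (F ∩ F'))
      in𝓙 = from (realises F∈𝓖 (Π χ (F ∩ F'))) (F ∩ F' , (F' , F'∈𝓖 , F'≢F , refl) , refl)
      D⊆ : D ⊆ Π χ (F ∩ F')
      D⊆ {i} i∈D with vertex-of-colour F∈𝓖 i
      ... | j , j∈F , χj≡i = subst (_∈ Π χ (F ∩ F')) χj≡i (∈-Π⁺ (x∈p∩q⁺ (j∈F , j∈F')))
        where
        j∈trace : j ∈ trace F
        j∈trace = x∈p∩q⁺ (j∈F , ∈-tabulate⁺ ([]=⇒lookup (subst (_∈ D) (sym χj≡i) i∈D)))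
        j∈F' : j ∈ F'
        j∈F' = proj₁ (x∈p∩q⁻ _ _ (subst (j ∈_) same j∈trace))

  -- Uncovered sets of size at most k-2 force |𝓖| ≤ C(n,k-2) (enlarge them first).
  small-uncovered-bound : ∀ D → Uncovered 𝓙 D → ∣ D ∣ ≤ k ∸ 2 → length 𝓖 ≤ n C (k ∸ 2)
  small-uncovered-bound D uncovered small with enlarge D (k ∸ 2) small (m∸n≤m k 2)
  ... | D' , D⊆D' , ∣D'∣≡ = subst (λ t → length 𝓖 ≤ n C t) ∣D'∣≡
        (uncovered-bound D' (λ B B∈𝓙 D'⊆B → uncovered B B∈𝓙 (⊆-trans D⊆D' D'⊆B)))

  singleton-kernel : ∀ {F} → F ∈ₗ 𝓖 → ∀ c → 𝓙 ⁅ c ⁆ →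
    ∃[ A ] (InI A F 𝓖 × (∀ {j} → j ∈ A → χ j ≡ c) × ∣ A ∣ ≡ 1)
  singleton-kernel {F} F∈𝓖 c c∈𝓙 with to (realises F∈𝓖 ⁅ c ⁆) c∈𝓙
  ... | A , (F' , F'∈𝓖 , F'≢F , A≡) , ΠA≡ = A , (F' , F'∈𝓖 , F'≢F , A≡) , colour , ≤-antisym upper lower
    where
    colour : ∀ {j} → j ∈ A → χ j ≡ c
    colour {j} j∈A = x∈⁅y⁆⇒x≡y c (subst (χ j ∈_) ΠA≡ (∈-Π⁺ j∈A))
    upper : ∣ A ∣ ≤ 1
    upper = subst (∣ A ∣ ≤_) (partite F∈𝓖 c) (p⊆q⇒∣p∣≤∣q∣ (λ {j} j∈A →
      x∈p∩q⁺ (proj₁ (x∈p∩q⁻ _ _ (subst (j ∈_) A≡ j∈A)) , ∈-Part⁺ {χ = χ} (colour j∈A))))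
    lower : 1 ≤ ∣ A ∣
    lower with ∈-Π⁻ {S = A} (subst (c ∈_) (sym ΠA≡) (x∈⁅x⁆ c))
    ... | j , j∈A , _ = ∈⇒1≤∣p∣ j∈A

-- In an s-star f with kernel A, if U avoids A and |U| + 2 ≤ s then some petal
-- other than f i₀ avoids U: the petals meeting U would contain distinct
-- vertices of U, as distinct petals share only A.
petal-avoiding : ∀ {n} s (f : Fin s → Subset n) (i₀ : Fin s) (A U : Subset n) →
  (∀ i j → i ≢ j → f i ∩ f j ≡ A) → (∀ {u} → u ∈ U → u ∉ A) → 2 + ∣ U ∣ ≤ s →
  ∃[ i ] (i ≢ i₀ × f i ∩ U ≡ ⊥)
petal-avoiding {n} (suc s) f i₀ A U star U∩A≡∅ room with any? (λ j → (f (punchIn i₀ j) ∩ U) ≟ₛ ⊥)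
... | yes (j , e) = punchIn i₀ j , punchInᵢ≢i i₀ j , e
... | no none = ⊥-elim (<⇒≱ (s≤s⁻¹ room) s≤∣U∣)
  where
  meets : ∀ j → Nonempty (f (punchIn i₀ j) ∩ U)
  meets j with nonempty? (f (punchIn i₀ j) ∩ U)
  ... | yes ne = ne
  ... | no e = ⊥-elim (none (j , Empty-unique e))
  u : Fin s → Fin n
  u j = proj₁ (meets j)
  u∈petal : ∀ j → u j ∈ f (punchIn i₀ j)
  u∈petal j = proj₁ (x∈p∩q⁻ _ _ (proj₂ (meets j)))
  u∈U : ∀ j → u j ∈ U
  u∈U j = proj₂ (x∈p∩q⁻ _ _ (proj₂ (meets j)))
  u-injective : ∀ {j j'} → u j ≡ u j' → j ≡ j'
  u-injective {j} {j'} e with j ≟ᶠ j'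
  ... | yes j≡j' = j≡j'
  ... | no j≢j' = ⊥-elim (U∩A≡∅ (u∈U j) (subst (u j ∈_) kernel (x∈p∩q⁺ (u∈petal j , u∈petal'))))
    where
    kernel : f (punchIn i₀ j) ∩ f (punchIn i₀ j') ≡ A
    kernel = star _ _ (j≢j' ∘ punchIn-injective i₀ j j')
    u∈petal' : u j ∈ f (punchIn i₀ j')
    u∈petal' = subst (_∈ f (punchIn i₀ j')) (sym e) (u∈petal j')
  s≤∣U∣ : s ≤ ∣ U ∣
  s≤∣U∣ = subst (_≤ ∣ U ∣) (length-tabulate u)
            (count-elements U (List.tabulate u) (Unique-tabulate⁺ u-injective) (All-tabulate⁺ u∈U))

⋃< : ∀ {n} → (ℕ → Subset n) → ℕ → Subset n
⋃< g zero = ⊥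
⋃< g (suc t) = g t ∪ ⋃< g t

∈⋃<⁻ : ∀ {n} (g : ℕ → Subset n) t {u} → u ∈ ⋃< g t → ∃[ i ] (i < t × u ∈ g i)
∈⋃<⁻ g zero u∈ = ⊥-elim (∉⊥ u∈)
∈⋃<⁻ g (suc t) u∈ with x∈p∪q⁻ (g t) (⋃< g t) u∈
... | inj₁ u∈gt = t , ≤-refl , u∈gt
... | inj₂ u∈⋃ with ∈⋃<⁻ g t u∈⋃
... | i , i<t , u∈gi = i , m<n⇒m<1+n i<t , u∈gi

⊆⋃< : ∀ {n} (g : ℕ → Subset n) t i → i < t → g i ⊆ ⋃< g t
⊆⋃< g (suc t) i i<1+t u∈ with i ≟ℕ t
... | yes refl = x∈p∪q⁺ (inj₁ u∈)
... | no i≢t = x∈p∪q⁺ (inj₂ (⊆⋃< g t i (≤∧≢⇒< (s≤s⁻¹ i<1+t) i≢t) u∈))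

∣⋃<∣≤ : ∀ {n} (g : ℕ → Subset n) k t → (∀ i → i < t → ∣ g i ∣ ≡ k) → ∣ ⋃< g t ∣ ≤ t * k
∣⋃<∣≤ {n} g k zero _ = ≤-reflexive (∣⊥∣≡0 n)
∣⋃<∣≤ g k (suc t) sizes = ≤-trans (∣p∪q∣≤∣p∣+∣q∣ (g t) (⋃< g t))
  (+-mono-≤ (≤-reflexive (sizes t ≤-refl)) (∣⋃<∣≤ g k t (λ i i<t → sizes i (m<n⇒m<1+n i<t))))

setAt : ∀ {n} → (ℕ → Subset n) → ℕ → Subset n → ℕ → Subset n
setAt g m h i with i ≟ℕ m
... | yes _ = h
... | no _ = g i

setAt-here : ∀ {n} g m (h : Subset n) → setAt g m h m ≡ h
setAt-here g m h with m ≟ℕ m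
... | yes _ = refl
... | no m≢m = ⊥-elim (m≢m refl)

setAt-there : ∀ {n} g m (h : Subset n) i → i ≢ m → setAt g m h i ≡ g i
setAt-there g m h i i≢m with i ≟ℕ m
... | yes i≡m = ⊥-elim (i≢m i≡m)
... | no _ = refl

-- A path of m+2 edges of size k spans at most (m+2)k ≤ lk ≤ s vertices.
room-in-star : ∀ {k l s} m → 1 ≤ k → 2 + m ≤ l → k * l ≤ s → 2 + m * k ≤ s
room-in-star {k} {l} {s} m 1≤k m+2≤l kl≤s = begin
  2 + m * k          ≤⟨ +-mono-≤ 1≤k (+-monoˡ-≤ (m * k) 1≤k) ⟩
  (2 + m) * k        ≤⟨ *-monoˡ-≤ k m+2≤l ⟩
  l * k              ≡⟨ *-comm l k ⟩
  k * l              ≤⟨ kl≤s ⟩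
  s ∎
  where open ≤-Reasoning

module PathConstruction {n k s : ℕ} (𝓖 : Family n) (χ : Fin n → Fin k) (𝓙 : SetFamily k)
  (H : IsHomogeneousWith n k s 𝓖 χ 𝓙) (l : ℕ) (1≤k : 1 ≤ k) (kl≤s : k * l ≤ s) where

  open Homogeneous 𝓖 χ 𝓙 H

  -- A linear path edge 0, …, edge m in 𝓖 together with two singleton patterns
  -- {c} ≠ {d}, such that the vertices of colour c on the last edge lie on no
  -- earlier edge (so the next edge may be attached there).
  record PathPrefix (m : ℕ) : Set where
    field
      edge : ℕ → Subset n
      c d : Fin k
      c≢d : c ≢ d
      c-pattern : 𝓙 ⁅ c ⁆
      d-pattern : 𝓙 ⁅ d ⁆
      edge∈𝓖 : ∀ i → i ≤ m → edge i ∈ₗ 𝓖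
      consecutive : ∀ i → i < m → ∣ edge i ∩ edge (suc i) ∣ ≡ 1
      far : ∀ i j → suc i < j → j ≤ m → edge i ∩ edge j ≡ ⊥
      fresh : ∀ {v} → v ∈ edge m → χ v ≡ c → ∀ i → i < m → v ∉ edge i

  record NextEdge {m} (P : PathPrefix m) : Set where
    open PathPrefix P
    field
      next : Subset n
      next∈𝓖 : next ∈ₗ 𝓖
      joint : Subset n
      last∩next : edge m ∩ next ≡ joint
      joint-size : ∣ joint ∣ ≡ 1
      joint-colour : ∀ {j} → j ∈ joint → χ j ≡ c
      avoids : ∀ {x} i → i < m → x ∈ next → x ∉ edge i

  -- Take the star at the last edge whose kernel is the colour-c vertex realising
  -- {c}; as the path so far has at most mk ≤ s-2 vertices, some other petal
  -- avoids it.
  next-edge : ∀ {m} (P : PathPrefix m) → 2 + m ≤ l → NextEdge P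
  next-edge {m} P m+2≤l = record
    { next = f petal ; next∈𝓖 = f∈𝓖 petal ; joint = A
    ; last∩next = trans (cong (_∩ f petal) (sym f-last)) (star i-last petal (petal≢ ∘ sym))
    ; joint-size = ∣A∣≡1 ; joint-colour = A-colour
    ; avoids = avoids }
    where
    open PathPrefix P
    last∈𝓖 : edge m ∈ₗ 𝓖
    last∈𝓖 = edge∈𝓖 m ≤-refl
    kernel : ∃[ A ] (InI A (edge m) 𝓖 × (∀ {j} → j ∈ A → χ j ≡ c) × ∣ A ∣ ≡ 1)
    kernel = singleton-kernel last∈𝓖 c c-pattern
    A : Subset n
    A = proj₁ kernel
    A-inI : InI A (edge m) 𝓖
    A-inI = proj₁ (proj₂ kernel)
    A-colour : ∀ {j} → j ∈ A → χ j ≡ c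
    A-colour = proj₁ (proj₂ (proj₂ kernel))
    ∣A∣≡1 : ∣ A ∣ ≡ 1
    ∣A∣≡1 = proj₂ (proj₂ (proj₂ kernel))
    A⊆last : A ⊆ edge m
    A⊆last {u} u∈A = proj₁ (x∈p∩q⁻ _ _ (subst (u ∈_) (proj₂ (proj₂ (proj₂ A-inI))) u∈A))
    the-star : HasStar s 𝓖 (edge m) A
    the-star = stars last∈𝓖 A A-inI
    f : Fin s → Subset n
    f = proj₁ the-star
    f∈𝓖 : ∀ i → f i ∈ₗ 𝓖
    f∈𝓖 = proj₁ (proj₂ the-star)
    i-last : Fin s
    i-last = proj₁ (proj₁ (proj₂ (proj₂ the-star)))
    f-last : f i-last ≡ edge m
    f-last = proj₂ (proj₁ (proj₂ (proj₂ the-star)))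
    star : ∀ i j → i ≢ j → f i ∩ f j ≡ A
    star = proj₂ (proj₂ (proj₂ the-star))
    U : Subset n
    U = ⋃< edge m
    U∩A≡∅ : ∀ {u} → u ∈ U → u ∉ A
    U∩A≡∅ u∈U u∈A with ∈⋃<⁻ edge m u∈U
    ... | i , i<m , u∈edge = fresh (A⊆last u∈A) (A-colour u∈A) i i<m u∈edge
    room : 2 + ∣ U ∣ ≤ s
    room = ≤-trans (+-monoʳ-≤ 2 (∣⋃<∣≤ edge k m (λ i i<m → uniform (edge∈𝓖 i (<⇒≤ i<m)))))
                   (room-in-star m 1≤k m+2≤l kl≤s)
    chosen : ∃[ i ] (i ≢ i-last × f i ∩ U ≡ ⊥)
    chosen = petal-avoiding s f i-last A U star U∩A≡∅ room
    petal : Fin s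
    petal = proj₁ chosen
    petal≢ : petal ≢ i-last
    petal≢ = proj₁ (proj₂ chosen)
    avoids : ∀ {x} i → i < m → x ∈ f petal → x ∉ edge i
    avoids {x} i i<m x∈next x∈edge =
      ∉⊥ (subst (x ∈_) (proj₂ (proj₂ chosen)) (x∈p∩q⁺ (x∈next , ⊆⋃< edge m i i<m x∈edge)))

  -- Appending the next edge; the roles of c and d swap, since the vertices of
  -- colour d on the new edge are not on the joint (which has colour c).
  extend : ∀ {m} → PathPrefix m → 2 + m ≤ l → PathPrefix (suc m)
  extend {m} P m+2≤l = record
    { edge = edge' ; c = d ; d = c ; c≢d = c≢d ∘ sym ; c-pattern = d-pattern ; d-pattern = c-pattern
    ; edge∈𝓖 = edge∈𝓖' ; consecutive = consecutive' ; far = far' ; fresh = fresh' }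
    where
    open PathPrefix P
    open NextEdge (next-edge P m+2≤l)
    edge' : ℕ → Subset n
    edge' = setAt edge (suc m) next
    new : edge' (suc m) ≡ next
    new = setAt-here edge (suc m) next
    old : ∀ {i} → i < suc m → edge' i ≡ edge i
    old {i} i<1+m = setAt-there edge (suc m) next i (<⇒≢ i<1+m)
    edge∈𝓖' : ∀ i → i ≤ suc m → edge' i ∈ₗ 𝓖
    edge∈𝓖' i i≤1+m with m≤n⇒m<n∨m≡n i≤1+m
    ... | inj₂ refl = subst (_∈ₗ 𝓖) (sym new) next∈𝓖
    ... | inj₁ i<1+m = subst (_∈ₗ 𝓖) (sym (old i<1+m)) (edge∈𝓖 i (s≤s⁻¹ i<1+m))
    consecutive' : ∀ i → i < suc m → ∣ edge' i ∩ edge' (suc i) ∣ ≡ 1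
    consecutive' i i<1+m with m≤n⇒m<n∨m≡n (s≤s⁻¹ i<1+m)
    ... | inj₂ refl = trans (cong ∣_∣ (trans (cong₂ _∩_ (old i<1+m) new) last∩next)) joint-size
    ... | inj₁ i<m = trans (cong ∣_∣ (cong₂ _∩_ (old i<1+m) (old (s≤s i<m)))) (consecutive i i<m)
    far' : ∀ i j → suc i < j → j ≤ suc m → edge' i ∩ edge' j ≡ ⊥
    far' i j 1+i<j j≤1+m with m≤n⇒m<n∨m≡n j≤1+m
    ... | inj₂ refl = trans (cong₂ _∩_ (old (<-trans (n<1+n i) 1+i<j)) new)
                        (∉-all⇒⊥ (λ x∈ → avoids i (s≤s⁻¹ 1+i<j) (proj₂ (x∈p∩q⁻ _ _ x∈)) (proj₁ (x∈p∩q⁻ _ _ x∈))))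
    ... | inj₁ j<1+m = trans (cong₂ _∩_ (old (<-trans (n<1+n i) (<-trans 1+i<j j<1+m))) (old j<1+m)) (far i j 1+i<j (s≤s⁻¹ j<1+m))
    fresh' : ∀ {v} → v ∈ edge' (suc m) → χ v ≡ d → ∀ i → i < suc m → v ∉ edge' i
    fresh' {v} v∈new χv≡d i i<1+m v∈old with m≤n⇒m<n∨m≡n (s≤s⁻¹ i<1+m)
    ... | inj₂ refl = c≢d (trans (sym (joint-colour (subst (v ∈_) last∩next (x∈p∩q⁺ (v∈edge , v∈next))))) χv≡d)
      where
      v∈next : v ∈ next
      v∈next = subst (v ∈_) new v∈new
      v∈edge : v ∈ edge m
      v∈edge = subst (v ∈_) (old i<1+m) v∈old
    ... | inj₁ i<m = avoids i i<m (subst (v ∈_) new v∈new) (subst (v ∈_) (old i<1+m) v∈old)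

  grow : ∀ {F₀} → F₀ ∈ₗ 𝓖 → ∀ c d → c ≢ d → 𝓙 ⁅ c ⁆ → 𝓙 ⁅ d ⁆ → ∀ m → suc m ≤ l → PathPrefix m
  grow {F₀} F₀∈𝓖 c d c≢d c∈𝓙 d∈𝓙 zero _ = record
    { edge = λ _ → F₀ ; c = c ; d = d ; c≢d = c≢d ; c-pattern = c∈𝓙 ; d-pattern = d∈𝓙
    ; edge∈𝓖 = λ _ _ → F₀∈𝓖 ; consecutive = λ _ () ; far = λ { _ zero () _ ; _ (suc _) _ () }
    ; fresh = λ _ _ _ () }
  grow F₀∈𝓖 c d c≢d c∈𝓙 d∈𝓙 (suc m) m+2≤l = extend (grow F₀∈𝓖 c d c≢d c∈𝓙 d∈𝓙 m (<⇒≤ m+2≤l)) m+2≤l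

  prefix⇒path : ∀ {m} → PathPrefix m → suc m ≡ l → ContainsPath l 𝓖
  prefix⇒path {m} P refl =
      (λ i → edge (toℕ i))
    , (λ i → edge∈𝓖 (toℕ i) (s≤s⁻¹ (toℕ<n i)))
    , (λ i j j≡1+i → subst (λ t → ∣ edge (toℕ i) ∩ edge t ∣ ≡ 1) (sym j≡1+i)
                       (consecutive (toℕ i) (s≤s⁻¹ (subst (_< suc m) j≡1+i (toℕ<n j)))))
    , (λ i j 1+i<j → far (toℕ i) (toℕ j) 1+i<j (s≤s⁻¹ (toℕ<n j)))
    where open PathPrefix P

  two-singletons⇒path : ∀ {F₀} → F₀ ∈ₗ 𝓖 → ∀ c d → c ≢ d → 𝓙 ⁅ c ⁆ → 𝓙 ⁅ d ⁆ → 1 ≤ l → ContainsPath l 𝓖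
  two-singletons⇒path F₀∈𝓖 c d c≢d c∈𝓙 d∈𝓙 1≤l =
    prefix⇒path (grow F₀∈𝓖 c d c≢d c∈𝓙 d∈𝓙 (l ∸ 1) (≤-reflexive (m+[n∸m]≡n 1≤l))) (m+[n∸m]≡n 1≤l)

co-singleton : ∀ {k} → Fin k → Subset k
co-singleton a = ∁ ⁅ a ⁆

co-pair : ∀ {k} → Fin k → Fin k → Subset k
co-pair a b = ∁ (⁅ a ⁆ ∪ ⁅ b ⁆)

∈-co-singleton⁺ : ∀ {k} {i a : Fin k} → i ≢ a → i ∈ co-singleton a
∈-co-singleton⁺ i≢a = x∉p⇒x∈∁p (x≢y⇒x∉⁅y⁆ i≢a)

∈-co-singleton⁻ : ∀ {k} {i a : Fin k} → i ∈ co-singleton a → i ≢ a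
∈-co-singleton⁻ i∈ = x∉⁅y⁆⇒x≢y (x∈∁p⇒x∉p i∈)

∈-co-pair⁺ : ∀ {k} {i a b : Fin k} → i ≢ a → i ≢ b → i ∈ co-pair a b
∈-co-pair⁺ {a = a} {b} i≢a i≢b = x∉p⇒x∈∁p (λ i∈ → [ i≢a ∘ x∈⁅y⁆⇒x≡y a , i≢b ∘ x∈⁅y⁆⇒x≡y b ]′ (x∈p∪q⁻ ⁅ a ⁆ ⁅ b ⁆ i∈))

∣co-singleton∣ : ∀ {k} (a : Fin k) → ∣ co-singleton a ∣ ≡ k ∸ 1
∣co-singleton∣ {k} a = trans (∣∁p∣≡n∸∣p∣ ⁅ a ⁆) (cong (k ∸_) (∣⁅x⁆∣≡1 a))

-- {a} ⊂ {a,b}, so |{a,b}| ≥ 2 and its complement has at most k-2 elements.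
∣co-pair∣≤ : ∀ {k} (a b : Fin k) → a ≢ b → ∣ co-pair a b ∣ ≤ k ∸ 2
∣co-pair∣≤ {k} a b a≢b = subst (_≤ k ∸ 2) (sym (∣∁p∣≡n∸∣p∣ (⁅ a ⁆ ∪ ⁅ b ⁆))) (∸-monoʳ-≤ k 2≤∣ab∣)
  where
  a⊂ab : ⁅ a ⁆ ⊂ ⁅ a ⁆ ∪ ⁅ b ⁆
  a⊂ab = p⊆p∪q ⁅ b ⁆ , b , x∈p∪q⁺ (inj₂ (x∈⁅x⁆ b)) , x≢y⇒x∉⁅y⁆ (a≢b ∘ sym)
  2≤∣ab∣ : 2 ≤ ∣ ⁅ a ⁆ ∪ ⁅ b ⁆ ∣
  2≤∣ab∣ = subst (_< ∣ ⁅ a ⁆ ∪ ⁅ b ⁆ ∣) (∣⁅x⁆∣≡1 a) (p⊂q⇒∣p∣<∣q∣ a⊂ab)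

two-outside : ∀ {k} → 4 ≤ k → (U : Subset k) → ∣ U ∣ ≤ 2 → ∃[ w₁ ] ∃[ w₂ ] (w₁ ≢ w₂ × w₁ ∉ U × w₂ ∉ U)
two-outside {k} 4≤k U ∣U∣≤2 with ∃∉ U (≤-trans (s≤s ∣U∣≤2) (≤-trans (n≤1+n 3) 4≤k))
... | w₁ , w₁∉U with ∃∉ (⁅ w₁ ⁆ ∪ U) (≤-trans (s≤s ∣w₁U∣≤3) 4≤k)
  where
  ∣w₁U∣≤3 : ∣ ⁅ w₁ ⁆ ∪ U ∣ ≤ 3
  ∣w₁U∣≤3 = ≤-trans (∣p∪q∣≤∣p∣+∣q∣ ⁅ w₁ ⁆ U) (+-mono-≤ (≤-reflexive (∣⁅x⁆∣≡1 w₁)) ∣U∣≤2)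
... | w₂ , w₂∉ = w₁ , w₂ , (λ w₁≡w₂ → w₂∉ (x∈p∪q⁺ (inj₁ (subst (_∈ ⁅ w₁ ⁆) w₁≡w₂ (x∈⁅x⁆ w₁)))))
                 , w₁∉U , (λ w₂∈U → w₂∉ (x∈p∪q⁺ (inj₂ w₂∈U)))

<k∸1⇒≤k∸2 : ∀ k d → d < k ∸ 1 → d ≤ k ∸ 2
<k∸1⇒≤k∸2 (suc (suc k)) d d<k+1 = s≤s⁻¹ d<k+1

module Type1Classification {k : ℕ} (𝓙 : SetFamily k) (𝓙? : ∀ B → Dec (𝓙 B))
  (proper : ∀ B → 𝓙 B → B ≢ ⊤) (∩-closed : ∀ B C → 𝓙 B → 𝓙 C → 𝓙 (B ∩ C))
  (4≤k : 4 ≤ k) (covers : ∀ D → ∣ D ∣ ≤ k ∸ 2 → ∃[ B ] (𝓙 B × D ⊆ B))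
  (no-two-singletons : ∀ a b → a ≢ b → 𝓙 ⁅ a ⁆ → ¬ 𝓙 ⁅ b ⁆) where

  -- Members are proper, so the only member containing [k]∖{a} is [k]∖{a} itself.
  co-singleton-maximal : ∀ a → ¬ 𝓙 (co-singleton a) → ∀ {B} → 𝓙 B → ¬ (co-singleton a ⊆ B)
  co-singleton-maximal a a-missing {B} B∈𝓙 co-a⊆B with a ∈? B
  ... | yes a∈B = proper B B∈𝓙 (⊆-antisym ⊆⊤ (λ {i} _ → all i))
    where
    all : ∀ i → i ∈ B
    all i with i ≟ᶠ a
    ... | yes refl = a∈B
    ... | no i≢a = co-a⊆B (∈-co-singleton⁺ i≢a)
  ... | no a∉B = a-missing (subst 𝓙 (⊆-antisym B⊆co-a co-a⊆B) B∈𝓙)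
    where
    B⊆co-a : B ⊆ co-singleton a
    B⊆co-a {i} i∈B = ∈-co-singleton⁺ (λ i≡a → a∉B (subst (_∈ B) i≡a i∈B))

  co-pair-separates : ∀ a b → ¬ 𝓙 (co-singleton a) → ∀ {B} → 𝓙 B → co-pair a b ⊆ B → b ∉ B
  co-pair-separates a b a-missing {B} B∈𝓙 ab⊆B b∈B =
    co-singleton-maximal a a-missing B∈𝓙 (λ {i} i∈ → all i (∈-co-singleton⁻ i∈))
    where
    all : ∀ i → i ≢ a → i ∈ B
    all i i≢a with i ≟ᶠ b
    ... | yes refl = b∈B
    ... | no i≢b = ab⊆B (∈-co-pair⁺ i≢a i≢b)

  Separated : Fin k → Set
  Separated w = (∃[ B ] (𝓙 B × w ∈ B)) × (∀ z → z ≢ w → ∃[ B ] (𝓙 B × w ∈ B × z ∉ B))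

  -- A separated colour is a singleton pattern: intersect the separators over
  -- all colours.
  singleton-from-separators : ∀ w → Separated w → 𝓙 ⁅ w ⁆
  singleton-from-separators w ((B₀ , B₀∈𝓙 , w∈B₀) , separators) =
    subst 𝓙 (⊆-antisym meet⊆w w⊆meet) (meet∈𝓙 (allFin k))
    where
    separator : ∀ z → ∃[ B ] (𝓙 B × w ∈ B × (z ≢ w → z ∉ B))
    separator z with z ≟ᶠ w
    ... | yes z≡w = B₀ , B₀∈𝓙 , w∈B₀ , (λ z≢w _ → z≢w z≡w)
    ... | no z≢w with separators z z≢w
    ...   | B , B∈𝓙 , w∈B , z∉B = B , B∈𝓙 , w∈B , (λ _ → z∉B)
    meet : List (Fin k) → Subset k
    meet = foldr (λ z acc → proj₁ (separator z) ∩ acc) B₀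
    meet∈𝓙 : ∀ zs → 𝓙 (meet zs)
    meet∈𝓙 [] = B₀∈𝓙
    meet∈𝓙 (z ∷ zs) = ∩-closed _ _ (proj₁ (proj₂ (separator z))) (meet∈𝓙 zs)
    w∈meet : ∀ zs → w ∈ meet zs
    w∈meet [] = w∈B₀
    w∈meet (z ∷ zs) = x∈p∩q⁺ (proj₁ (proj₂ (proj₂ (separator z))) , w∈meet zs)
    z∉meet : ∀ {z} zs → z ∈ₗ zs → z ≢ w → z ∉ meet zs
    z∉meet (z ∷ zs) (here refl) z≢w z∈ = proj₂ (proj₂ (proj₂ (separator z))) z≢w (proj₁ (x∈p∩q⁻ _ _ z∈))
    z∉meet (_ ∷ zs) (there z∈zs) z≢w z∈ = z∉meet zs z∈zs z≢w (proj₂ (x∈p∩q⁻ _ _ z∈))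
    meet⊆w : meet (allFin k) ⊆ ⁅ w ⁆
    meet⊆w {y} y∈ with y ≟ᶠ w
    ... | yes refl = x∈⁅x⁆ w
    ... | no y≢w = ⊥-elim (z∉meet (allFin k) (∈-allFin y) y≢w y∈)
    w⊆meet : ⁅ w ⁆ ⊆ meet (allFin k)
    w⊆meet y∈ = subst (_∈ meet (allFin k)) (sym (x∈⁅y⁆⇒x≡y w y∈)) (w∈meet (allFin k))

  -- Not every co-singleton lies in 𝓙: otherwise every singleton would.
  some-co-singleton-missing : ¬ (∀ a → 𝓙 (co-singleton a))
  some-co-singleton-missing all-in with two-outside 4≤k ⊥ (≤-trans (≤-reflexive (∣⊥∣≡0 k)) z≤n)
  ... | w₁ , w₂ , w₁≢w₂ , _ , _ =
    no-two-singletons w₁ w₂ w₁≢w₂ (singleton-from-separators w₁ (separated w₁)) (singleton-from-separators w₂ (separated w₂))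
    where
    separated : ∀ w → Separated w
    separated w with ∃∉ ⁅ w ⁆ (subst (_< k) (sym (∣⁅x⁆∣≡1 w)) (≤-trans (s≤s (s≤s z≤n)) 4≤k))
    ... | other , other∉ =
        (co-singleton other , all-in other , ∈-co-singleton⁺ (x∉⁅y⁆⇒x≢y other∉ ∘ sym))
      , (λ z z≢w → co-singleton z , all-in z , ∈-co-singleton⁺ (z≢w ∘ sym) , (λ z∈ → ∈-co-singleton⁻ z∈ refl))

  -- No two co-singletons are missing: if [k]∖{x} and [k]∖{y} both are, every
  -- colour w ∉ {x,y} is separated by covers of co-pairs, giving two singletons.
  at-most-one-missing : ∀ x y → x ≢ y → ¬ (¬ 𝓙 (co-singleton x) × ¬ 𝓙 (co-singleton y))
  at-most-one-missing x y x≢y (x-missing , y-missing)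
    with two-outside 4≤k (⁅ x ⁆ ∪ ⁅ y ⁆)
           (≤-trans (∣p∪q∣≤∣p∣+∣q∣ ⁅ x ⁆ ⁅ y ⁆) (≤-reflexive (cong₂ _+_ (∣⁅x⁆∣≡1 x) (∣⁅x⁆∣≡1 y))))
  ... | w₁ , w₂ , w₁≢w₂ , w₁∉ , w₂∉ =
    no-two-singletons w₁ w₂ w₁≢w₂ (singleton w₁ w₁∉) (singleton w₂ w₂∉)
    where
    singleton : ∀ w → w ∉ ⁅ x ⁆ ∪ ⁅ y ⁆ → 𝓙 ⁅ w ⁆
    singleton w w∉ = singleton-from-separators w (container , separators)
      where
      w≢x : w ≢ x
      w≢x = x∉⁅y⁆⇒x≢y (w∉ ∘ x∈p∪q⁺ ∘ inj₁)
      w≢y : w ≢ y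
      w≢y = x∉⁅y⁆⇒x≢y (w∉ ∘ x∈p∪q⁺ ∘ inj₂)
      container : ∃[ B ] (𝓙 B × w ∈ B)
      container with covers (co-pair x y) (∣co-pair∣≤ x y x≢y)
      ... | B , B∈𝓙 , xy⊆B = B , B∈𝓙 , xy⊆B (∈-co-pair⁺ w≢x w≢y)
      -- a cover of [k]∖{a,z} contains w and, as [k]∖{a} ∉ 𝓙, misses z
      via : ∀ a z → a ≢ z → w ≢ a → w ≢ z → ¬ 𝓙 (co-singleton a) → ∃[ B ] (𝓙 B × w ∈ B × z ∉ B)
      via a z a≢z w≢a w≢z a-missing with covers (co-pair a z) (∣co-pair∣≤ a z a≢z)
      ... | B , B∈𝓙 , az⊆B = B , B∈𝓙 , az⊆B (∈-co-pair⁺ w≢a w≢z) , co-pair-separates a z a-missing B∈𝓙 az⊆B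
      separators : ∀ z → z ≢ w → ∃[ B ] (𝓙 B × w ∈ B × z ∉ B)
      separators z z≢w with z ≟ᶠ x
      ... | yes refl = via y z (x≢y ∘ sym) w≢y (z≢w ∘ sym) y-missing
      ... | no z≢x = via x z (z≢x ∘ sym) w≢x (z≢w ∘ sym) x-missing

  -- Exactly one co-singleton [k]∖{x} is missing; it is uncovered and every
  -- smaller set is covered, so 𝓙 has rank k-1 and type 1.
  rank-and-type : HasRank 𝓙 (k ∸ 1) × IsType1 𝓙
  rank-and-type with any? (λ a → ¬? (𝓙? (co-singleton a)))
  ... | no none = ⊥-elim (some-co-singleton-missing (λ a → decidable-stable (𝓙? (co-singleton a)) (λ a-missing → none (a , a-missing))))
  ... | yes (x , x-missing) = rank , x , x-missing , others-present
    where
    others-present : ∀ y → y ≢ x → 𝓙 (co-singleton y)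
    others-present y y≢x = decidable-stable (𝓙? (co-singleton y)) (λ y-missing → at-most-one-missing x y (y≢x ∘ sym) (x-missing , y-missing))
    minimal : ∀ D → Uncovered 𝓙 D → k ∸ 1 ≤ ∣ D ∣
    minimal D uncovered with k ∸ 1 ≤? ∣ D ∣
    ... | yes k-1≤∣D∣ = k-1≤∣D∣
    ... | no k-1≰∣D∣ with covers D (<k∸1⇒≤k∸2 k ∣ D ∣ (≰⇒> k-1≰∣D∣))
    ... | B , B∈𝓙 , D⊆B = ⊥-elim (uncovered B B∈𝓙 D⊆B)
    rank : HasRank 𝓙 (k ∸ 1)
    rank = (co-singleton x , (λ B B∈𝓙 → co-singleton-maximal x x-missing B∈𝓙) , ∣co-singleton∣ x) , minimal

some-member : ∀ {A : Set} (L : List A) → 0 < length L → ∃[ x ] (x ∈ₗ L)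
some-member (x ∷ _) _ = x , here refl

-- A (k,s)-homogeneous family with more than C(n,k-2) members and no linear path
-- of length l (k ≥ 4, s ≥ kl) has an intersection pattern of rank k-1 and type 1:
-- its pattern covers all (k-2)-sets by counting, and has no two singletons
-- since these would produce a path.
large-path-free⇒type1 : ∀ {n k s l} (𝓖 : Family n) → IsHomogeneous n k s 𝓖 →
  4 ≤ k → 1 ≤ l → k * l ≤ s → ¬ ContainsPath l 𝓖 → n C (k ∸ 2) < length 𝓖 →
  IsHomogeneousType1 n k s 𝓖
large-path-free⇒type1 {n} {k} {s} {l} 𝓖 (χ , 𝓙 , H) 4≤k 1≤l kl≤s path-free large =
  χ , 𝓙 , H , Type1Classification.rank-and-type 𝓙 (𝓙? F₀∈𝓖) proper ∩-closed 4≤k covers no-two-singletons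
  where
  open Homogeneous 𝓖 χ 𝓙 H
  open PathConstruction 𝓖 χ 𝓙 H l (≤-trans (s≤s z≤n) 4≤k) kl≤s
  F₀ : Subset n
  F₀ = proj₁ (some-member 𝓖 (≤-trans (s≤s z≤n) large))
  F₀∈𝓖 : F₀ ∈ₗ 𝓖
  F₀∈𝓖 = proj₂ (some-member 𝓖 (≤-trans (s≤s z≤n) large))
  covers : ∀ D → ∣ D ∣ ≤ k ∸ 2 → ∃[ B ] (𝓙 B × D ⊆ B)
  covers D small with anySubset? (λ B → 𝓙? F₀∈𝓖 B ×-dec (D ⊆? B))
  ... | yes cover = cover
  ... | no none = ⊥-elim (<⇒≱ large (small-uncovered-bound D (λ B B∈𝓙 D⊆B → none (B , B∈𝓙 , D⊆B)) small))
  no-two-singletons : ∀ a b → a ≢ b → 𝓙 ⁅ a ⁆ → ¬ 𝓙 ⁅ b ⁆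
  no-two-singletons a b a≢b a∈𝓙 b∈𝓙 = path-free (two-singletons⇒path F₀∈𝓖 a b a≢b a∈𝓙 b∈𝓙 1≤l)

path-free-⊆ : ∀ {n l} {𝓕 𝓖 : Family n} → (∀ {F} → F ∈ₗ 𝓖 → F ∈ₗ 𝓕) → ¬ ContainsPath l 𝓕 → ¬ ContainsPath l 𝓖
path-free-⊆ 𝓖⊆𝓕 path-free (g , g∈𝓖 , consecutive , far) = path-free (g , 𝓖⊆𝓕 ∘ g∈𝓖 , consecutive , far)

_∈ₗ?_ : ∀ {n} (F : Subset n) (𝓖 : Family n) → Dec (F ∈ₗ 𝓖)
F ∈ₗ? 𝓖 = Any.any? (F ≟ₛ_) 𝓖

_∖_ : ∀ {n} → Family n → Family n → Family n
𝓕 ∖ 𝓖 = filter (λ F → ¬? (F ∈ₗ? 𝓖)) 𝓕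

∖⊆ : ∀ {n} (𝓕 𝓖 : Family n) {F} → F ∈ₗ 𝓕 ∖ 𝓖 → F ∈ₗ 𝓕
∖⊆ 𝓕 𝓖 F∈ = proj₁ (∈-filter⁻ (λ F → ¬? (F ∈ₗ? 𝓖)) {xs = 𝓕} F∈)

split-off : ∀ {n} (𝓕 𝓖 : Family n) → Unique 𝓕 → Unique 𝓖 → (∀ {F} → F ∈ₗ 𝓖 → F ∈ₗ 𝓕) → 𝓕 ↭ (𝓖 ++ 𝓕 ∖ 𝓖)
split-off {n} 𝓕 𝓖 unique-𝓕 unique-𝓖 𝓖⊆𝓕 =
  ∼bag⇒↭ (unique∧set⇒bag unique-𝓕 (++⁺ unique-𝓖 (filter⁺ outside? unique-𝓕) disjoint) (mk⇔ into back))
  where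
  outside? : (F : Subset n) → Dec (¬ F ∈ₗ 𝓖)
  outside? F = ¬? (F ∈ₗ? 𝓖)
  disjoint : ∀ {F} → ¬ (F ∈ₗ 𝓖 × F ∈ₗ 𝓕 ∖ 𝓖)
  disjoint (F∈𝓖 , F∈rest) = proj₂ (∈-filter⁻ outside? {xs = 𝓕} F∈rest) F∈𝓖
  into : ∀ {F} → F ∈ₗ 𝓕 → F ∈ₗ 𝓖 ++ 𝓕 ∖ 𝓖
  into {F} F∈𝓕 with F ∈ₗ? 𝓖
  ... | yes F∈𝓖 = ∈-++⁺ˡ F∈𝓖
  ... | no F∉𝓖 = ∈-++⁺ʳ 𝓖 (∈-filter⁺ outside? F∈𝓕 F∉𝓖)
  back : ∀ {F} → F ∈ₗ 𝓖 ++ 𝓕 ∖ 𝓖 → F ∈ₗ 𝓕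
  back F∈ with ∈-++⁻ 𝓖 F∈
  ... | inj₁ F∈𝓖 = 𝓖⊆𝓕 F∈𝓖
  ... | inj₂ F∈rest = ∖⊆ 𝓕 𝓖 F∈rest

Decomposition : (n k s p q : ℕ) → Family n → Set₁
Decomposition n k s p q 𝓕 =
  Σ (List (Family n)) λ 𝓖s → Σ (Family n) λ 𝓕₀ →
    (𝓕 ↭ (concat 𝓖s ++ 𝓕₀)) × All (IsHomogeneousType1 n k s) 𝓖s × p * length 𝓕₀ ≤ q * (n C (k ∸ 2))

module Decompose (k l s p q : ℕ) (4≤k : 4 ≤ k) (1≤l : 1 ≤ l) (kl≤s : k * l ≤ s)
  (homogeneous-part : HomogeneousConstant k s p q) (n : ℕ) where

  -- While p|𝓕| > q·C(n,k-2), the homogeneous subfamily 𝓖 ⊆ 𝓕 of size ≥ (p/q)|𝓕|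
  -- has more than C(n,k-2) members, hence is of type 1; split it off and recurse
  -- on 𝓕 ∖ 𝓖, which is strictly smaller (N bounds the length).
  decompose : ∀ N (𝓕 : Family n) → length 𝓕 ≤ N → IsKFamily n k 𝓕 → ¬ ContainsPath l 𝓕 →
    Decomposition n k s p q 𝓕
  decompose N 𝓕 ∣𝓕∣≤N k-family path-free with p * length 𝓕 ≤? q * (n C (k ∸ 2))
  ... | yes small = [] , 𝓕 , ↭-refl , [] , small
  decompose zero 𝓕 ∣𝓕∣≤0 _ _ | no big =
    ⊥-elim (big (subst (_≤ q * (n C (k ∸ 2))) (sym (trans (cong (p *_) (n≤0⇒n≡0 ∣𝓕∣≤0)) (*-zeroʳ p))) z≤n))
  decompose (suc N) 𝓕 ∣𝓕∣≤1+N (unique-𝓕 , uniform-𝓕) path-free | no big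
    with homogeneous-part n 𝓕 (unique-𝓕 , uniform-𝓕)
  ... | 𝓖 , unique-𝓖 , 𝓖⊆𝓕 , 𝓖-homogeneous , p∣𝓕∣≤q∣𝓖∣ =
    𝓖 ∷ 𝓖s , 𝓕₀ , 𝓕↭ , 𝓖-type1 ∷ 𝓖s-type1 , bound
    where
    large : n C (k ∸ 2) < length 𝓖
    large = *-cancelˡ-< q _ _ (<-≤-trans (≰⇒> big) p∣𝓕∣≤q∣𝓖∣)
    𝓖-type1 : IsHomogeneousType1 n k s 𝓖
    𝓖-type1 = large-path-free⇒type1 𝓖 𝓖-homogeneous 4≤k 1≤l kl≤s (path-free-⊆ 𝓖⊆𝓕 path-free) large
    𝓕↭𝓖+rest : 𝓕 ↭ (𝓖 ++ 𝓕 ∖ 𝓖)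
    𝓕↭𝓖+rest = split-off 𝓕 𝓖 unique-𝓕 unique-𝓖 𝓖⊆𝓕
    ∣rest∣≤N : length (𝓕 ∖ 𝓖) ≤ N
    ∣rest∣≤N = s≤s⁻¹ (begin-strict
      length (𝓕 ∖ 𝓖)                 <⟨ +-monoˡ-< (length (𝓕 ∖ 𝓖)) (≤-<-trans z≤n large) ⟩
      length 𝓖 + length (𝓕 ∖ 𝓖)      ≡⟨ sym (trans (↭-length 𝓕↭𝓖+rest) (length-++ 𝓖)) ⟩
      length 𝓕                       ≤⟨ ∣𝓕∣≤1+N ⟩
      suc N ∎)
      where open ≤-Reasoning
    rest : Decomposition n k s p q (𝓕 ∖ 𝓖)
    rest = decompose N (𝓕 ∖ 𝓖) ∣rest∣≤N
             (filter⁺ (λ F → ¬? (F ∈ₗ? 𝓖)) unique-𝓕 , uniform-𝓕 ∘ ∖⊆ 𝓕 𝓖)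
             (path-free-⊆ (∖⊆ 𝓕 𝓖) path-free)
    𝓖s : List (Family n)
    𝓖s = proj₁ rest
    𝓕₀ : Family n
    𝓕₀ = proj₁ (proj₂ rest)
    𝓖s-type1 : All (IsHomogeneousType1 n k s) 𝓖s
    𝓖s-type1 = proj₁ (proj₂ (proj₂ (proj₂ rest)))
    bound : p * length 𝓕₀ ≤ q * (n C (k ∸ 2))
    bound = proj₂ (proj₂ (proj₂ (proj₂ rest)))
    𝓕↭ : 𝓕 ↭ (concat (𝓖 ∷ 𝓖s) ++ 𝓕₀)
    𝓕↭ = ↭-trans 𝓕↭𝓖+rest
           (↭-trans (++⁺ˡ 𝓖 (proj₁ (proj₂ (proj₂ rest)))) (↭-reflexive (sym (++-assoc 𝓖 (concat 𝓖s) 𝓕₀))))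

-- Theorem 3.9.  The constant c(k,s) is p/q.
theorem3p9 : (k l s p q : ℕ) → 4 ≤ k → 1 ≤ l → k * l ≤ s → 0 < p → 0 < q →
    HomogeneousConstant k s p q →
    (n : ℕ) (𝓕 : Family n) → IsKFamily n k 𝓕 → ¬ ContainsPath l 𝓕 →
    Σ (List (Family n)) λ 𝓖s → Σ (Family n) λ 𝓕₀ →
      (𝓕 ↭ (concat 𝓖s ++ 𝓕₀)) × All (IsHomogeneousType1 n k s) 𝓖s × p * length 𝓕₀ ≤ q * (n C (k ∸ 2))
theorem3p9 k l s p q 4≤k 1≤l kl≤s _ _ homogeneous-part n 𝓕 k-family path-free =
  Decompose.decompose k l s p q 4≤k 1≤l kl≤s homogeneous-part n (length 𝓕) 𝓕 ≤-refl k-family path-free
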